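{- Let $\{q_n\}$ be the Fibonacci Quilt sequence, and define $d_n$, $c_n$, $b_n$ as in the context. For all $n\ge7$, $$d_n=c_n+c_{n-1}+\cdots+c_0=c_n+d_{n-1},\qquad c_n=d_{n-5}+c_{n-2}-b_{n-2},\qquad b_n=d_{n-7},$$ and consequently, for all $n\ge9$, $$d_n=d_{n-1}+d_{n-2}-d_{n-3}+d_{n-5}-d_{n-9}.$$
   Context: Given an increasing sequence of positive integers $\{q_i\}_{i\ge1}$, a decomposition $m=q_{\ell_1}+\cdots+q_{\ell_t}$ with $q_{\ell_1}>\cdots>q_{\ell_t}$ is FQ-legal if $|\ell_i-\ell_j|\notin\{0,1,3,4\}$ for all $i\neq j$ and $\{1,3\}\not\subset\{\ell_1,\dots,\ell_t\}$. The Fibonacci Quilt sequence is the increasing sequence $\{q_i\}_{i\ge1}$ of positive integers in which each $q_i$ is the smallest positive integer with no FQ-legal decomposition using elements of $\{q_1,\dots,q_{i-1}\}$. For $n\ge1$: $d_n$ is the number of FQ-legal decompositions using only elements of $\{q_1,\dots,q_n\}$ (equivalently, the number of index sets $S\subseteq\{1,\dots,n\}$, including $S=\emptyset$, with no two elements differing by $1,3$ or $4$ and $\{1,3\}\not\subset S$), regardless of which integer is decomposed; $c_n$ is the number of those that use $q_n$; $b_n$ is the number of those that use both $q_n$ and $q_{n-2}$. Also $d_0=c_0=1$. -}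

module Defs where

open import Data.Bool using (Bool; true; false; not; _∧_; _∨_)
open import Data.Nat using (ℕ; zero; suc; _+_; _∸_; _≡ᵇ_; ∣_-_∣)
open import Data.List using (List; []; _∷_; [_]; _++_; map; length; filterᵇ; upTo)
open import Data.Bool.ListAction using (all; any)
open import Data.Nat.ListAction using (sum)

-- All subsets of {1,…,n}, each represented as a list of its elements
-- (in decreasing order, no repetitions).
subsets : ℕ → List (List ℕ)
subsets zero    = [ [] ]
subsets (suc n) = subsets n ++ map (suc n ∷_) (subsets n)

elemᵇ : ℕ → List ℕ → Bool
elemᵇ x = any (x ≡ᵇ_)

-- two distinct indices may coexist iff their difference is not 1, 3 or 4
-- (difference 0 cannot occur between distinct elements of a set)
pairOK : ℕ → ℕ → Bool
pairOK i j = not ((∣ i - j ∣ ≡ᵇ 1) ∨ (∣ i - j ∣ ≡ᵇ 3) ∨ (∣ i - j ∣ ≡ᵇ 4))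

pairwiseOK : List ℕ → Bool
pairwiseOK []       = true
pairwiseOK (x ∷ xs) = all (pairOK x) xs ∧ pairwiseOK xs

FQLegal : List ℕ → Bool
FQLegal S = pairwiseOK S ∧ not (elemᵇ 1 S ∧ elemᵇ 3 S)

count : ℕ → (List ℕ → Bool) → ℕ
count n P = length (filterᵇ (λ S → FQLegal S ∧ P S) (subsets n))

-- d_n : all FQ-legal decompositions using q_1..q_n (including the empty one)
d : ℕ → ℕ
d n = count n (λ _ → true)

-- c_n : those using q_n ; convention c_0 = 1
c : ℕ → ℕ
c zero    = 1
c (suc n) = count (suc n) (elemᵇ (suc n))

b : ℕ → ℕ
b n = count n (λ S → elemᵇ n S ∧ elemᵇ (n ∸ 2) S)

sumC : ℕ → ℕ
sumC n = sum (map c (upTo (suc n)))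

-- Peel off the largest indices.  Splitting on whether n is used gives
-- d_n = c_n + d_{n-1}.  A legal set containing n avoids n-1, n-3, n-4, so
-- split on n-2: without it the rest is any legal subset of {1,…,n-5}, giving
-- d_{n-5}; with it, the rest together with n-2 is one of the c_{n-2} sets,
-- minus the b_{n-2} of them that contain n-4.  If n and n-2 are both used,
-- every index from n-6 to n-1 is excluded, so b_n = d_{n-7}.  Combining the
-- three relations eliminates c and b and yields the nine-term recurrence.

module Submission where

open import Defs
open import Data.Nat using (ℕ; _+_; _∸_; _≤_)
open import Data.Product using (_×_)
open import Relation.Binary.PropositionalEquality using (_≡_)

open import Data.Bool using (Bool; true; false; not; _∧_; _∨_)
open import Data.Bool.ListAction using (all)
open import Data.Bool.Properties using (∧-zeroʳ; ∧-identityʳ; ∧-assoc; ∧-comm)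
open import Data.List using (List; []; _∷_; [_]; _++_; map; length; filterᵇ; upTo)
open import Data.List.Properties using (length-++; filter-++; map-++; upTo-∷ʳ)
open import Data.List.Relation.Unary.All as All using (All; []; _∷_)
import Data.List.Relation.Unary.All.Properties as All
open import Data.Nat using (zero; suc; _<_; _≡ᵇ_; _≟_; ∣_-_∣; z≤n)
open import Data.Nat.ListAction using (sum)
open import Data.Nat.ListAction.Properties using (sum-++)
open import Data.Nat.Properties
open import Data.Nat.Tactic.RingSolver using (solve-∀)
open import Data.Product using (_,_)
open import Function.Bundles using (mk⇔)
open import Relation.Binary.PropositionalEquality using (refl; sym; trans; cong; cong₂; subst; module ≡-Reasoning)
open import Relation.Nullary.Decidable using (dec-true; dec-false; does-⇔)

tally : ℕ → (List ℕ → Bool) → ℕ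
tally n p = length (filterᵇ p (subsets n))

length-filterᵇ-map : ∀ {A B : Set} (p : B → Bool) (f : A → B) xs →
                     length (filterᵇ p (map f xs)) ≡ length (filterᵇ (λ x → p (f x)) xs)
length-filterᵇ-map p f []       = refl
length-filterᵇ-map p f (x ∷ xs) with p (f x)
... | true  = cong suc (length-filterᵇ-map p f xs)
... | false = length-filterᵇ-map p f xs

length-filterᵇ-congᴬ : ∀ {A : Set} {Q : A → Set} {p q : A → Bool} →
                       (∀ {x} → Q x → p x ≡ q x) → ∀ {xs} → All Q xs →
                       length (filterᵇ p xs) ≡ length (filterᵇ q xs)
length-filterᵇ-congᴬ         p≗q []                        = refl
length-filterᵇ-congᴬ {p = p} {q} p≗q (_∷_ {x} {xs} qx qxs) with p x | q x | p≗q qx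
... | true  | .true  | refl = cong suc (length-filterᵇ-congᴬ p≗q qxs)
... | false | .false | refl = length-filterᵇ-congᴬ p≗q qxs

length-filterᵇ-split : ∀ {A : Set} (q p : A → Bool) xs →
                       length (filterᵇ p xs) ≡
                       length (filterᵇ (λ x → q x ∧ p x) xs) + length (filterᵇ (λ x → not (q x) ∧ p x) xs)
length-filterᵇ-split q p []       = refl
length-filterᵇ-split q p (x ∷ xs) with q x | p x
... | true  | true  = cong suc (length-filterᵇ-split q p xs)
... | true  | false = length-filterᵇ-split q p xs
... | false | true  = trans (cong suc (length-filterᵇ-split q p xs)) (sym (+-suc _ _))
... | false | false = length-filterᵇ-split q p xs

length-filterᵇ-false : ∀ {A : Set} (xs : List A) → length (filterᵇ (λ _ → false) xs) ≡ 0
length-filterᵇ-false []       = refl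
length-filterᵇ-false (_ ∷ xs) = length-filterᵇ-false xs

subsets-bounded : ∀ n → All (All (_≤ n)) (subsets n)
subsets-bounded zero    = [] ∷ []
subsets-bounded (suc n) =
  All.++⁺ (All.map weaken (subsets-bounded n))
          (All.map⁺ (All.map (λ S≤n → ≤-refl ∷ weaken S≤n) (subsets-bounded n)))
  where
  weaken : ∀ {S} → All (_≤ n) S → All (_≤ suc n) S
  weaken = All.map m≤n⇒m≤1+n

tally-suc : ∀ k p → tally (suc k) p ≡ tally k p + tally k (λ S → p (suc k ∷ S))
tally-suc k p = begin
  length (filterᵇ p (subsets k ++ map (suc k ∷_) (subsets k)))
    ≡⟨ cong length (filter-++ _ (subsets k) _) ⟩
  length (filterᵇ p (subsets k) ++ filterᵇ p (map (suc k ∷_) (subsets k)))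
    ≡⟨ length-++ (filterᵇ p (subsets k)) ⟩
  tally k p + length (filterᵇ p (map (suc k ∷_) (subsets k)))
    ≡⟨ cong (tally k p +_) (length-filterᵇ-map p (suc k ∷_) (subsets k)) ⟩
  tally k p + tally k (λ S → p (suc k ∷ S))
    ∎
  where open ≡-Reasoning

tally-cong : ∀ k {p q} → (∀ {S} → All (_≤ k) S → p S ≡ q S) → tally k p ≡ tally k q
tally-cong k p≗q = length-filterᵇ-congᴬ p≗q (subsets-bounded k)

tally-split : ∀ k q p → tally k p ≡ tally k (λ S → q S ∧ p S) + tally k (λ S → not (q S) ∧ p S)
tally-split k q p = length-filterᵇ-split q p (subsets k)

tally-none : ∀ k {p} → (∀ {S} → All (_≤ k) S → p S ≡ false) → tally k p ≡ 0
tally-none k p≡false = trans (tally-cong k p≡false) (length-filterᵇ-false (subsets k))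

tally-drop-top : ∀ k (p : List ℕ → Bool) → (∀ {S} → p (suc k ∷ S) ≡ false) →
                 tally (suc k) p ≡ tally k p
tally-drop-top k p top-false = begin
  tally (suc k) p                            ≡⟨ tally-suc k p ⟩
  tally k p + tally k (λ S → p (suc k ∷ S))  ≡⟨ cong (tally k p +_) (tally-none k (λ _ → top-false)) ⟩
  tally k p + 0                              ≡⟨ +-identityʳ _ ⟩
  tally k p                                  ∎
  where open ≡-Reasoning

tally-keep-top : ∀ k (p : List ℕ → Bool) → (∀ {S} → All (_≤ k) S → p S ≡ false) →
                 tally (suc k) p ≡ tally k (λ S → p (suc k ∷ S))
tally-keep-top k p rest-false =
  trans (tally-suc k p) (cong (_+ tally k (λ S → p (suc k ∷ S))) (tally-none k rest-false))

∈ᵇ-∷-self : ∀ x S → elemᵇ x (x ∷ S) ≡ true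
∈ᵇ-∷-self x S = cong (_∨ elemᵇ x S) (dec-true (x ≟ x) refl)

∈ᵇ-∷-< : ∀ {x y} S → x < y → elemᵇ x (y ∷ S) ≡ elemᵇ x S
∈ᵇ-∷-< {x} {y} S x<y = cong (_∨ elemᵇ x S) (dec-false (x ≟ y) (<⇒≢ x<y))

∈ᵇ-bounded : ∀ {k x S} → All (_≤ k) S → k < x → elemᵇ x S ≡ false
∈ᵇ-bounded                  []            k<x = refl
∈ᵇ-bounded {x = x} {y ∷ _} (y≤k ∷ S≤k) k<x =
  cong₂ _∨_ (dec-false (x ≟ y) (>⇒≢ (≤-<-trans y≤k k<x))) (∈ᵇ-bounded S≤k k<x)

tally-∉top : ∀ k (p : List ℕ → Bool) → tally (suc k) (λ S → not (elemᵇ (suc k) S) ∧ p S) ≡ tally k p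
tally-∉top k p = trans
  (tally-drop-top k (λ S → not (elemᵇ (suc k) S) ∧ p S)
    (λ {S} → cong (λ b → not b ∧ p (suc k ∷ S)) (∈ᵇ-∷-self (suc k) S)))
  (tally-cong k (λ {S} S≤k → cong (λ b → not b ∧ p S) (∈ᵇ-bounded S≤k ≤-refl)))

tally-∈top : ∀ k (p : List ℕ → Bool) →
             tally (suc k) (λ S → elemᵇ (suc k) S ∧ p S) ≡ tally k (λ S → p (suc k ∷ S))
tally-∈top k p = trans
  (tally-keep-top k (λ S → elemᵇ (suc k) S ∧ p S)
    (λ {S} S≤k → cong (λ b → b ∧ p S) (∈ᵇ-bounded S≤k ≤-refl)))
  (tally-cong k (λ {S} _ → cong (λ b → b ∧ p (suc k ∷ S)) (∈ᵇ-∷-self (suc k) S)))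

∸-≡ᵇ-swap : ∀ {n x j} → x ≤ n → j ≤ n → (n ∸ x ≡ᵇ j) ≡ (n ∸ j ≡ᵇ x)
∸-≡ᵇ-swap {n} {x} {j} x≤n j≤n = does-⇔
  (mk⇔ (λ n∸x≡j → trans (cong (n ∸_) (sym n∸x≡j)) (m∸[m∸n]≡n x≤n))
       (λ n∸j≡x → trans (cong (n ∸_) (sym n∸j≡x)) (m∸[m∸n]≡n j≤n)))
  (n ∸ x ≟ j) (n ∸ j ≟ x)

pairOK-suc : ∀ x → pairOK (suc x) x ≡ false
pairOK-suc x = cong (λ δ → not ((δ ≡ᵇ 1) ∨ (δ ≡ᵇ 3) ∨ (δ ≡ᵇ 4)))
  (trans (m≤n⇒∣n-m∣≡n∸m (n≤1+n x)) (m+n∸n≡m 1 x))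

pairOK-below : ∀ k {x} → x ≤ 3 + k → pairOK (4 + k) x ≡ not ((3 + k ≡ᵇ x) ∨ (1 + k ≡ᵇ x) ∨ (k ≡ᵇ x))
pairOK-below k {x} x≤3+k = begin
  pairOK (4 + k) x
    ≡⟨ cong (λ δ → not ((δ ≡ᵇ 1) ∨ (δ ≡ᵇ 3) ∨ (δ ≡ᵇ 4))) distance ⟩
  not ((3 + k ∸ x ≡ᵇ 0) ∨ (3 + k ∸ x ≡ᵇ 2) ∨ (3 + k ∸ x ≡ᵇ 3))
    ≡⟨ cong not (cong₂ _∨_ (swap z≤n) (cong₂ _∨_ (swap (m≤m+n 2 (1 + k))) (swap (m≤m+n 3 k)))) ⟩
  not ((3 + k ≡ᵇ x) ∨ (1 + k ≡ᵇ x) ∨ (k ≡ᵇ x))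
    ∎
  where
  open ≡-Reasoning
  distance : ∣ 4 + k - x ∣ ≡ suc (3 + k ∸ x)
  distance = trans (m≤n⇒∣n-m∣≡n∸m (m≤n⇒m≤1+n x≤3+k)) (+-∸-assoc 1 x≤3+k)
  swap : ∀ {j} → j ≤ 3 + k → (3 + k ∸ x ≡ᵇ j) ≡ (3 + k ∸ j ≡ᵇ x)
  swap = ∸-≡ᵇ-swap x≤3+k

not-∨-interleave : ∀ a b c A B C →
  not (a ∨ b ∨ c) ∧ (not A ∧ (not B ∧ not C)) ≡ not (a ∨ A) ∧ (not (b ∨ B) ∧ not (c ∨ C))
not-∨-interleave true  b     c     A B C = refl
not-∨-interleave false true  c     A B C = sym (∧-zeroʳ (not A))
not-∨-interleave false false true  A B C = sym (trans (cong (not A ∧_) (∧-zeroʳ (not B))) (∧-zeroʳ (not A)))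
not-∨-interleave false false false A B C = refl

all-pairOK-below : ∀ k {S} → All (_≤ 3 + k) S →
  all (pairOK (4 + k)) S ≡ not (elemᵇ (3 + k) S) ∧ (not (elemᵇ (1 + k) S) ∧ not (elemᵇ k S))
all-pairOK-below k []                      = refl
all-pairOK-below k {x ∷ S} (x≤3+k ∷ S≤3+k) = trans
  (cong₂ _∧_ (pairOK-below k x≤3+k) (all-pairOK-below k S≤3+k))
  (not-∨-interleave (3 + k ≡ᵇ x) (1 + k ≡ᵇ x) (k ≡ᵇ x) (elemᵇ (3 + k) S) (elemᵇ (1 + k) S) (elemᵇ k S))

-- Since 4 + k ∉ {1, 3}, the {1,3}-clause of FQLegal only concerns S.
legal-∷ : ∀ k {S} → All (_≤ 3 + k) S →
  FQLegal (4 + k ∷ S) ≡ not (elemᵇ (3 + k) S) ∧ (not (elemᵇ (1 + k) S) ∧ (not (elemᵇ k S) ∧ FQLegal S))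
legal-∷ k {S} S≤3+k = begin
  FQLegal (4 + k ∷ S)
    ≡⟨ ∧-assoc (all (pairOK (4 + k)) S) (pairwiseOK S) _ ⟩
  all (pairOK (4 + k)) S ∧ FQLegal S
    ≡⟨ cong (_∧ FQLegal S) (all-pairOK-below k S≤3+k) ⟩
  (not (elemᵇ (3 + k) S) ∧ (not (elemᵇ (1 + k) S) ∧ not (elemᵇ k S))) ∧ FQLegal S
    ≡⟨ ∧-assoc (not (elemᵇ (3 + k) S)) _ _ ⟩
  not (elemᵇ (3 + k) S) ∧ ((not (elemᵇ (1 + k) S) ∧ not (elemᵇ k S)) ∧ FQLegal S)
    ≡⟨ cong (not (elemᵇ (3 + k) S) ∧_) (∧-assoc (not (elemᵇ (1 + k) S)) _ _) ⟩
  not (elemᵇ (3 + k) S) ∧ (not (elemᵇ (1 + k) S) ∧ (not (elemᵇ k S) ∧ FQLegal S))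
    ∎
  where open ≡-Reasoning

legal-adjacent : ∀ x S → FQLegal (suc x ∷ x ∷ S) ≡ false
legal-adjacent x S = cong
  (λ b → ((b ∧ all (pairOK (suc x)) S) ∧ pairwiseOK (x ∷ S)) ∧
         not (elemᵇ 1 (suc x ∷ x ∷ S) ∧ elemᵇ 3 (suc x ∷ x ∷ S)))
  (pairOK-suc x)

legal-∷-gap₂ : ∀ k {S} → All (_≤ 2 + k) S →
  FQLegal (5 + k ∷ 3 + k ∷ S) ≡ not (elemᵇ (2 + k) S) ∧ (not (elemᵇ (1 + k) S) ∧ FQLegal (3 + k ∷ S))
legal-∷-gap₂ k {S} S≤2+k
  rewrite legal-∷ (1 + k) (n≤1+n (3 + k) ∷ All.map (λ x≤ → ≤-trans x≤ (m≤n+m (2 + k) 2)) S≤2+k)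
        | ∈ᵇ-bounded (≤-refl ∷ All.map m≤n⇒m≤1+n S≤2+k) (≤-refl {4 + k})
        | ∈ᵇ-∷-< {2 + k} S ≤-refl
        | ∈ᵇ-∷-< {1 + k} S (n≤1+n (2 + k))
        = refl

d-tally : ∀ n → d n ≡ tally n FQLegal
d-tally n = tally-cong n (λ {S} _ → ∧-identityʳ (FQLegal S))

c-tally : ∀ k → c (suc k) ≡ tally k (λ S → FQLegal (suc k ∷ S))
c-tally k = trans
  (tally-cong (suc k) (λ {S} _ → ∧-comm (FQLegal S) (elemᵇ (suc k) S)))
  (tally-∈top k FQLegal)

c-tally₂ : ∀ k → c (2 + k) ≡ tally k (λ S → FQLegal (2 + k ∷ S))
c-tally₂ k = trans (c-tally (1 + k))
  (tally-drop-top k (λ S → FQLegal (2 + k ∷ S)) (λ {S} → legal-adjacent (1 + k) S))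

b-tally : ∀ k → b (2 + k) ≡ tally k (λ S → elemᵇ k S ∧ FQLegal (2 + k ∷ S))
b-tally k = begin
  b (2 + k)
    ≡⟨ tally-cong (2 + k) (λ {S} _ → rotate (FQLegal S) (elemᵇ (2 + k) S) (elemᵇ k S)) ⟩
  tally (2 + k) (λ S → elemᵇ (2 + k) S ∧ (elemᵇ k S ∧ FQLegal S))
    ≡⟨ tally-∈top (1 + k) (λ S → elemᵇ k S ∧ FQLegal S) ⟩
  tally (1 + k) (λ S → elemᵇ k (2 + k ∷ S) ∧ FQLegal (2 + k ∷ S))
    ≡⟨ tally-cong (1 + k) (λ {S} _ → cong (_∧ FQLegal (2 + k ∷ S)) (∈ᵇ-∷-< S (n≤1+n (1 + k)))) ⟩
  tally (1 + k) (λ S → elemᵇ k S ∧ FQLegal (2 + k ∷ S))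
    ≡⟨ tally-drop-top k (λ S → elemᵇ k S ∧ FQLegal (2 + k ∷ S))
         (λ {S} → trans (cong (elemᵇ k (suc k ∷ S) ∧_) (legal-adjacent (1 + k) S)) (∧-zeroʳ _)) ⟩
  tally k (λ S → elemᵇ k S ∧ FQLegal (2 + k ∷ S))
    ∎
  where
  open ≡-Reasoning
  rotate : ∀ x y z → x ∧ (y ∧ z) ≡ y ∧ (z ∧ x)
  rotate x y z = trans (∧-comm x (y ∧ z)) (∧-assoc y z x)

tally-legal-∷-gap₃ : ∀ m → tally (2 + m) (λ S → FQLegal (5 + m ∷ S)) ≡ d m
tally-legal-∷-gap₃ m = begin
  tally (2 + m) (λ S → FQLegal (5 + m ∷ S))
    ≡⟨ tally-cong (2 + m) unfold ⟩
  tally (2 + m) (λ S → not (elemᵇ (2 + m) S) ∧ (not (elemᵇ (1 + m) S) ∧ FQLegal S))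
    ≡⟨ tally-∉top (1 + m) (λ S → not (elemᵇ (1 + m) S) ∧ FQLegal S) ⟩
  tally (1 + m) (λ S → not (elemᵇ (1 + m) S) ∧ FQLegal S)
    ≡⟨ tally-∉top m FQLegal ⟩
  tally m FQLegal
    ≡⟨ sym (d-tally m) ⟩
  d m
    ∎
  where
  open ≡-Reasoning
  unfold : ∀ {S} → All (_≤ 2 + m) S →
           FQLegal (5 + m ∷ S) ≡ not (elemᵇ (2 + m) S) ∧ (not (elemᵇ (1 + m) S) ∧ FQLegal S)
  unfold S≤2+m
    rewrite legal-∷ (1 + m) (All.map (λ x≤ → ≤-trans x≤ (m≤n+m (2 + m) 2)) S≤2+m)
          | ∈ᵇ-bounded S≤2+m (m≤n+m (3 + m) 1)
          = refl

d≡c+d : ∀ k → d (suc k) ≡ c (suc k) + d k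
d≡c+d k = begin
  d (suc k)
    ≡⟨ tally-suc k (λ S → FQLegal S ∧ true) ⟩
  d k + tally k (λ S → FQLegal (suc k ∷ S) ∧ true)
    ≡⟨ cong (d k +_) (trans (tally-cong k (λ {S} _ → ∧-identityʳ (FQLegal (suc k ∷ S)))) (sym (c-tally k))) ⟩
  d k + c (suc k)
    ≡⟨ +-comm (d k) (c (suc k)) ⟩
  c (suc k) + d k
    ∎
  where open ≡-Reasoning

sumC-suc : ∀ n → sumC (suc n) ≡ sumC n + c (suc n)
sumC-suc n = begin
  sum (map c (upTo (suc (suc n))))
    ≡⟨ cong (λ is → sum (map c is)) (sym (upTo-∷ʳ (suc n))) ⟩
  sum (map c (upTo (suc n) ++ [ suc n ]))
    ≡⟨ cong sum (map-++ c (upTo (suc n)) [ suc n ]) ⟩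
  sum (map c (upTo (suc n)) ++ [ c (suc n) ])
    ≡⟨ sum-++ (map c (upTo (suc n))) [ c (suc n) ] ⟩
  sumC n + (c (suc n) + 0)
    ≡⟨ cong (sumC n +_) (+-identityʳ (c (suc n))) ⟩
  sumC n + c (suc n)
    ∎
  where open ≡-Reasoning

d≡sumC : ∀ n → d n ≡ sumC n
d≡sumC zero    = refl
d≡sumC (suc n) = begin
  d (suc n)           ≡⟨ d≡c+d n ⟩
  c (suc n) + d n     ≡⟨ +-comm (c (suc n)) (d n) ⟩
  d n + c (suc n)     ≡⟨ cong (_+ c (suc n)) (d≡sumC n) ⟩
  sumC n + c (suc n)  ≡⟨ sym (sumC-suc n) ⟩
  sumC (suc n)        ∎
  where open ≡-Reasoning

-- c (2 + k) ∸ b (2 + k): the decompositions using q_{k+2} but not q_k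
c∖b : ℕ → ℕ
c∖b k = tally k (λ S → not (elemᵇ k S) ∧ FQLegal (2 + k ∷ S))

c≡b+c∖b : ∀ k → c (2 + k) ≡ b (2 + k) + c∖b k
c≡b+c∖b k = begin
  c (2 + k)
    ≡⟨ c-tally₂ k ⟩
  tally k (λ S → FQLegal (2 + k ∷ S))
    ≡⟨ tally-split k (elemᵇ k) (λ S → FQLegal (2 + k ∷ S)) ⟩
  tally k (λ S → elemᵇ k S ∧ FQLegal (2 + k ∷ S)) + c∖b k
    ≡⟨ cong (_+ c∖b k) (sym (b-tally k)) ⟩
  b (2 + k) + c∖b k
    ∎
  where open ≡-Reasoning

c≡d+c∖b : ∀ m → c (5 + m) ≡ d m + c∖b (1 + m)
c≡d+c∖b m = begin
  c (5 + m)
    ≡⟨ c-tally₂ (3 + m) ⟩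
  tally (3 + m) (λ S → FQLegal (5 + m ∷ S))
    ≡⟨ tally-suc (2 + m) (λ S → FQLegal (5 + m ∷ S)) ⟩
  tally (2 + m) (λ S → FQLegal (5 + m ∷ S)) + tally (2 + m) (λ S → FQLegal (5 + m ∷ 3 + m ∷ S))
    ≡⟨ cong₂ _+_ (tally-legal-∷-gap₃ m) (tally-cong (2 + m) (legal-∷-gap₂ m)) ⟩
  d m + tally (2 + m) (λ S → not (elemᵇ (2 + m) S) ∧ (not (elemᵇ (1 + m) S) ∧ FQLegal (3 + m ∷ S)))
    ≡⟨ cong (d m +_) (tally-∉top (1 + m) (λ S → not (elemᵇ (1 + m) S) ∧ FQLegal (3 + m ∷ S))) ⟩
  d m + c∖b (1 + m)
    ∎
  where open ≡-Reasoning

c+b≡d+c : ∀ m → c (5 + m) + b (3 + m) ≡ d m + c (3 + m)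
c+b≡d+c m = begin
  c (5 + m) + b (3 + m)            ≡⟨ cong (_+ b (3 + m)) (c≡d+c∖b m) ⟩
  d m + c∖b (1 + m) + b (3 + m)    ≡⟨ +-assoc (d m) (c∖b (1 + m)) (b (3 + m)) ⟩
  d m + (c∖b (1 + m) + b (3 + m))  ≡⟨ cong (d m +_) (+-comm (c∖b (1 + m)) (b (3 + m))) ⟩
  d m + (b (3 + m) + c∖b (1 + m))  ≡⟨ cong (d m +_) (sym (c≡b+c∖b (1 + m))) ⟩
  d m + c (3 + m)                  ∎
  where open ≡-Reasoning

b≡d : ∀ m → b (7 + m) ≡ d m
b≡d m = begin
  b (7 + m)
    ≡⟨ b-tally (5 + m) ⟩
  tally (5 + m) (λ S → elemᵇ (5 + m) S ∧ FQLegal (7 + m ∷ S))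
    ≡⟨ tally-∈top (4 + m) (λ S → FQLegal (7 + m ∷ S)) ⟩
  tally (4 + m) (λ S → FQLegal (7 + m ∷ 5 + m ∷ S))
    ≡⟨ tally-cong (4 + m) (legal-∷-gap₂ (2 + m)) ⟩
  tally (4 + m) (λ S → not (elemᵇ (4 + m) S) ∧ (not (elemᵇ (3 + m) S) ∧ FQLegal (5 + m ∷ S)))
    ≡⟨ tally-∉top (3 + m) (λ S → not (elemᵇ (3 + m) S) ∧ FQLegal (5 + m ∷ S)) ⟩
  tally (3 + m) (λ S → not (elemᵇ (3 + m) S) ∧ FQLegal (5 + m ∷ S))
    ≡⟨ tally-∉top (2 + m) (λ S → FQLegal (5 + m ∷ S)) ⟩
  tally (2 + m) (λ S → FQLegal (5 + m ∷ S))
    ≡⟨ tally-legal-∷-gap₃ m ⟩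
  d m
    ∎
  where open ≡-Reasoning

nine-term-recurrence : ∀ {d₉ d₈ d₇ d₆ d₄ d₀ c₉ c₇ : ℕ} →
  d₉ ≡ c₉ + d₈ → d₇ ≡ c₇ + d₆ → c₉ + d₀ ≡ d₄ + c₇ →
  d₉ + d₆ + d₀ ≡ d₈ + d₇ + d₄
nine-term-recurrence {d₈ = d₈} {d₆ = d₆} {d₄} {d₀} {c₉} {c₇} refl refl c₉+d₀≡d₄+c₇ = begin
  c₉ + d₈ + d₆ + d₀      ≡⟨ regroup c₉ d₈ d₆ d₀ ⟩
  d₈ + d₆ + (c₉ + d₀)    ≡⟨ cong (d₈ + d₆ +_) c₉+d₀≡d₄+c₇ ⟩
  d₈ + d₆ + (d₄ + c₇)    ≡⟨ regroup′ d₈ d₆ d₄ c₇ ⟩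
  d₈ + (c₇ + d₆) + d₄    ∎
  where
  open ≡-Reasoning
  regroup : ∀ w x y z → w + x + y + z ≡ x + y + (w + z)
  regroup = solve-∀
  regroup′ : ∀ w x y z → w + x + (y + z) ≡ w + (z + x) + y
  regroup′ = solve-∀

∀-≥-from-+ : ∀ {P : ℕ → Set} m → (∀ k → P (m + k)) → ∀ n → m ≤ n → P n
∀-≥-from-+ {P} m P[m+_] n m≤n = subst P (m+[n∸m]≡n m≤n) (P[m+_] (n ∸ m))

lemma3p1 : ((n : ℕ) → 7 ≤ n →
             (d n ≡ sumC n)
             × (d n ≡ c n + d (n ∸ 1))
             × (c n + b (n ∸ 2) ≡ d (n ∸ 5) + c (n ∸ 2))
             × (b n ≡ d (n ∸ 7)))
           × ((n : ℕ) → 9 ≤ n →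
             d n + d (n ∸ 3) + d (n ∸ 9) ≡ d (n ∸ 1) + d (n ∸ 2) + d (n ∸ 5))
lemma3p1 =
  ∀-≥-from-+ 7 (λ k → d≡sumC (7 + k) , d≡c+d (6 + k) , c+b≡d+c (2 + k) , b≡d k) ,
  ∀-≥-from-+ 9 (λ k → nine-term-recurrence (d≡c+d (8 + k)) (d≡c+d (6 + k))
                        (trans (cong (c (9 + k) +_) (sym (b≡d k))) (c+b≡d+c (4 + k))))
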